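{- Let $p$ be a prime, let $e\geq 2$, $d\geq 2$ be integers and $\lambda\in\{1,\dots,\min(e,d-1)\}$. The map $$(\alpha_1,\dots,\alpha_d)\longmapsto (p^{\mu-\alpha_1},\dots,p^{\mu-\alpha_d}),\qquad \mu=\Big\lfloor \big(e+\textstyle\sum_{i=1}^d\alpha_i\big)/d\Big\rfloor=\big(e-\lambda+\textstyle\sum_{i=1}^d\alpha_i\big)/d,$$ is a bijection from $\mathcal R_\lambda(d,e)$ onto the set of $d$-dimensional vector-factorisations of $p^{e-\lambda}$. Its inverse is $(p^{\beta_1},\dots,p^{\beta_d})\longmapsto (B-\beta_1,\dots,B-\beta_d)$, where $B=\max(\beta_1,\dots,\beta_d)$.
   Context: A $d$-dimensional vector-factorisation of $p^m$ is a vector $(p^{\beta_1},\dots,p^{\beta_d})$ with $\beta_i\in\mathbb Z_{\geq0}$ and $\sum_i\beta_i=m$ (i.e. a vector of positive integers whose product is $p^m$). For $\lambda\in\{1,\dots,\min(e,d-1)\}$, $\mathcal R_\lambda(d,e)$ is the set of all $\alpha=(\alpha_1,\dots,\alpha_d)$ with non-negative integer entries such that $\min_i\alpha_i=0$, $d\cdot\max_i\alpha_i<e+\sum_{i=1}^d\alpha_i$, and $e+\sum_{i=1}^d\alpha_i\equiv\lambda\pmod d$. -}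

module Defs where

open import Data.Nat using (ℕ; zero; suc; _+_; _*_; _∸_; _^_; _≤_; _<_; _⊔_; NonZero)
open import Data.Nat.DivMod using (_/_; _%_)
open import Data.Vec using (Vec; map; sum; foldr)
open import Data.Vec.Relation.Unary.Any using (Any)
open import Data.Product using (Σ; _×_)
open import Relation.Binary.PropositionalEquality using (_≡_)

vmax : ∀ {d} → Vec ℕ d → ℕ
vmax = foldr _ _⊔_ 0

-- min_i α_i = 0  (entries are natural numbers, so the minimum is 0 iff some entry is 0)
MinZero : ∀ {d} → Vec ℕ d → Set
MinZero α = Any (_≡ 0) α

InR : (d e λ′ : ℕ) → .{{_ : NonZero d}} → Vec ℕ d → Set
InR d e λ′ α =
  MinZero α
  × (d * vmax α < e + sum α)
  × ((e + sum α) % d ≡ λ′ % d)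

IsVecFact : (p d m : ℕ) → Vec ℕ d → Set
IsVecFact p d m v = Σ (Vec ℕ d) (λ β → (v ≡ map (p ^_) β) × (sum β ≡ m))

mu : (d e : ℕ) → .{{_ : NonZero d}} → Vec ℕ d → ℕ
mu d e α = (e + sum α) / d

Φ : (p d e : ℕ) → .{{_ : NonZero d}} → Vec ℕ d → Vec ℕ d
Φ p d e α = map (λ a → p ^ (mu d e α ∸ a)) α

-- the claimed inverse, on exponent vectors: β ↦ (B-β₁,…,B-β_d), B = max βᵢ
Ψ : ∀ {d} → Vec ℕ d → Vec ℕ d
Ψ β = map (λ b → vmax β ∸ b) β

-- Proof idea: for α ∈ 𝓡_λ(d,e) the congruence condition says e + Σα = λ + μd, and the
-- maximum condition says every αᵢ ≤ μ. Hence βᵢ = μ − αᵢ are natural numbers with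
-- Σβ = dμ − Σα = e − λ. Since some αᵢ is 0, max β = μ, so (max β − βᵢ) recovers α.
-- Conversely, for Σβ = e − λ put B = max β and α = B − β: some αᵢ is 0, and
-- e + Σα = λ + dB, which gives both the congruence and, as λ ≥ 1, d·max α ≤ dB < e + Σα;
-- moreover μ(α) = B, so the map returns p^β. Injectivity of p^_ (p > 1) turns the
-- equation Φ α = p^β into an equation of exponent vectors.
module Submission where

open import Defs
open import Data.Nat using (ℕ; suc; _+_; _*_; _∸_; _^_; _≤_; _<_; z≤n; s≤s; NonZero; nonTrivial⇒n>1)
open import Data.Nat.Properties
open import Data.Nat.DivMod using (_/_; _%_; m≡m%n+[m/n]*n; [m+kn]%n≡m%n; +-distrib-/; m<n⇒m/n≡0; m<n⇒m%n≡m; m*n/n≡m; m*n%n≡0)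
open import Data.Nat.Primality using (Prime; prime⇒nonTrivial)
open import Data.Nat.Solver using (module +-*-Solver)
open import Data.Vec using (Vec; []; _∷_; map; sum)
open import Data.Vec.Properties using (map-∘; ∷-injective)
open import Data.Vec.Relation.Unary.All as All using (All; []; _∷_)
open import Data.Vec.Relation.Unary.Any as Any using (Any; here; there)
open import Data.Vec.Relation.Unary.Any.Properties using (map⁺)
open import Data.Product using (_×_; _,_)
open import Data.Sum using (inj₁; inj₂)
open import Data.Empty using (⊥-elim)
open import Relation.Binary using (tri<; tri≈; tri>)
open import Relation.Binary.PropositionalEquality
open +-*-Solver using (solve; _:+_; _:=_)

vmax-upperBound : ∀ {n} (v : Vec ℕ n) → All (_≤ vmax v) v
vmax-upperBound [] = []
vmax-upperBound (x ∷ v) =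
  m≤m⊔n x (vmax v) ∷ All.map (λ y≤m → ≤-trans y≤m (m≤n⊔m x (vmax v))) (vmax-upperBound v)

vmax-least : ∀ {n m} (v : Vec ℕ n) → All (_≤ m) v → vmax v ≤ m
vmax-least [] [] = z≤n
vmax-least (x ∷ v) (x≤m ∷ v≤m) = ⊔-lub x≤m (vmax-least v v≤m)

vmax-attained : ∀ {n} (v : Vec ℕ (suc n)) → Any (_≡ vmax v) v
vmax-attained (x ∷ []) = here (sym (⊔-identityʳ x))
vmax-attained (x ∷ v@(_ ∷ _)) with ⊔-sel x (vmax v)
... | inj₁ x⊔m≡x = here (sym x⊔m≡x)
... | inj₂ x⊔m≡m = there (Any.map (λ y≡m → trans y≡m (sym x⊔m≡m)) (vmax-attained v))

vmax-map-∸-≤ : ∀ {n} μ (α : Vec ℕ n) → vmax (map (μ ∸_) α) ≤ μ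
vmax-map-∸-≤ μ [] = z≤n
vmax-map-∸-≤ μ (x ∷ α) = ⊔-lub (m∸n≤m μ x) (vmax-map-∸-≤ μ α)

vmax-map-∸ : ∀ {n} μ (α : Vec ℕ n) → Any (_≡ 0) α → vmax (map (μ ∸_) α) ≡ μ
vmax-map-∸ μ α some0 = ≤-antisym (vmax-map-∸-≤ μ α) (μ≤vmax α some0)
  where
    μ≤vmax : ∀ {n} (α : Vec ℕ n) → Any (_≡ 0) α → μ ≤ vmax (map (μ ∸_) α)
    μ≤vmax (_ ∷ α) (here refl) = m≤m⊔n μ _
    μ≤vmax (x ∷ α) (there some0) = ≤-trans (μ≤vmax α some0) (m≤n⊔m (μ ∸ x) _)

sum-map-∸ : ∀ {n} μ (α : Vec ℕ n) → All (_≤ μ) α → sum (map (μ ∸_) α) + sum α ≡ n * μ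
sum-map-∸ μ [] [] = refl
sum-map-∸ {suc n} μ (x ∷ α) (x≤μ ∷ α≤μ) = begin
    (μ ∸ x + sum (map (μ ∸_) α)) + (x + sum α)
      ≡⟨ solve 4 (λ a b c d → (a :+ b) :+ (c :+ d) := (a :+ c) :+ (b :+ d)) refl (μ ∸ x) (sum (map (μ ∸_) α)) x (sum α) ⟩
    (μ ∸ x + x) + (sum (map (μ ∸_) α) + sum α)
      ≡⟨ cong₂ _+_ (m∸n+n≡m x≤μ) (sum-map-∸ μ α α≤μ) ⟩
    μ + n * μ ∎
  where open ≡-Reasoning

map-∸-involutive : ∀ {n} μ (α : Vec ℕ n) → All (_≤ μ) α → map (μ ∸_) (map (μ ∸_) α) ≡ α
map-∸-involutive μ [] [] = refl
map-∸-involutive μ (x ∷ α) (x≤μ ∷ α≤μ) = cong₂ _∷_ (m∸[m∸n]≡n x≤μ) (map-∸-involutive μ α α≤μ)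

map-vmax-∸-hasZero : ∀ {n} (β : Vec ℕ (suc n)) → Any (_≡ 0) (map (vmax β ∸_) β)
map-vmax-∸-hasZero β = map⁺ (Any.map (λ { refl → n∸n≡0 (vmax β) }) (vmax-attained β))

^-injectiveʳ : ∀ {p} → 1 < p → ∀ {a b} → p ^ a ≡ p ^ b → a ≡ b
^-injectiveʳ {p} 1<p {a} {b} pᵃ≡pᵇ with <-cmp a b
... | tri< a<b _ _ = ⊥-elim (<⇒≢ (^-monoʳ-< p 1<p a<b) pᵃ≡pᵇ)
... | tri≈ _ a≡b _ = a≡b
... | tri> _ _ b<a = ⊥-elim (<⇒≢ (^-monoʳ-< p 1<p b<a) (sym pᵃ≡pᵇ))

map-injective : ∀ {f : ℕ → ℕ} → (∀ {a b} → f a ≡ f b → a ≡ b) →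
                ∀ {n} (xs ys : Vec ℕ n) → map f xs ≡ map f ys → xs ≡ ys
map-injective f-inj [] [] _ = refl
map-injective f-inj (x ∷ xs) (y ∷ ys) eq with ∷-injective eq
... | fx≡fy , fxs≡fys = cong₂ _∷_ (f-inj fx≡fy) (map-injective f-inj xs ys fxs≡fys)

[m+kn]/n≡k : ∀ m k n .{{_ : NonZero n}} → m < n → (m + k * n) / n ≡ k
[m+kn]/n≡k m k n m<n = begin
    (m + k * n) / n     ≡⟨ +-distrib-/ m (k * n) remainders<n ⟩
    m / n + k * n / n   ≡⟨ cong₂ _+_ (m<n⇒m/n≡0 m<n) (m*n/n≡m k n) ⟩
    k                   ∎
  where
    open ≡-Reasoning
    remainders<n : m % n + k * n % n < n
    remainders<n = subst (_< n) (sym (trans (cong₂ _+_ (m<n⇒m%n≡m m<n) (m*n%n≡0 k n)) (+-identityʳ m))) m<n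

Φ-exponents : ∀ p d e .{{_ : NonZero d}} (α : Vec ℕ d) → Φ p d e α ≡ map (p ^_) (map (mu d e α ∸_) α)
Φ-exponents p d e α = map-∘ (p ^_) (mu d e α ∸_) α

module _ (d e λ′ : ℕ) .{{_ : NonZero d}} (λ′<d : λ′ < d) where

  InR-decomposition : (α : Vec ℕ d) → InR d e λ′ α → e + sum α ≡ λ′ + mu d e α * d
  InR-decomposition α (_ , _ , e+Σα≡λ′[d]) =
    trans (m≡m%n+[m/n]*n (e + sum α) d)
          (cong (_+ mu d e α * d) (trans e+Σα≡λ′[d] (m<n⇒m%n≡m λ′<d)))

  InR⇒entries≤mu : (α : Vec ℕ d) → InR d e λ′ α → All (_≤ mu d e α) α
  InR⇒entries≤mu α α∈R@(_ , d*maxα<e+Σα , _) =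
    All.map (λ x≤maxα → ≤-trans x≤maxα maxα≤μ) (vmax-upperBound α)
    where
      open ≤-Reasoning
      μ = mu d e α
      maxα≤μ : vmax α ≤ μ
      maxα≤μ = <⇒≤pred (*-cancelˡ-< d (vmax α) (suc μ) (begin-strict
        d * vmax α  <⟨ d*maxα<e+Σα ⟩
        e + sum α   ≡⟨ InR-decomposition α α∈R ⟩
        λ′ + μ * d  <⟨ +-monoˡ-< (μ * d) λ′<d ⟩
        d + μ * d   ≡⟨ cong (d +_) (*-comm μ d) ⟩
        d + d * μ   ≡⟨ *-suc d μ ⟨
        d * suc μ   ∎))

  sum-exponents : λ′ ≤ e → (α : Vec ℕ d) → InR d e λ′ α → sum (map (mu d e α ∸_) α) ≡ e ∸ λ′
  sum-exponents λ′≤e α α∈R = +-cancelʳ-≡ (sum α + λ′) _ _ (begin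
      S + (sum α + λ′)       ≡⟨ +-assoc S (sum α) λ′ ⟨
      S + sum α + λ′         ≡⟨ cong (_+ λ′) (sum-map-∸ μ α (InR⇒entries≤mu α α∈R)) ⟩
      d * μ + λ′             ≡⟨ cong (_+ λ′) (*-comm d μ) ⟩
      μ * d + λ′             ≡⟨ +-comm (μ * d) λ′ ⟩
      λ′ + μ * d             ≡⟨ InR-decomposition α α∈R ⟨
      e + sum α              ≡⟨ cong (_+ sum α) (m∸n+n≡m λ′≤e) ⟨
      (e ∸ λ′ + λ′) + sum α  ≡⟨ solve 3 (λ a b c → (a :+ b) :+ c := a :+ (c :+ b)) refl (e ∸ λ′) λ′ (sum α) ⟩
      (e ∸ λ′) + (sum α + λ′) ∎)
    where
      open ≡-Reasoning
      μ = mu d e α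
      S = sum (map (μ ∸_) α)

  Ψ-decomposition : λ′ ≤ e → (β : Vec ℕ d) → sum β ≡ e ∸ λ′ → e + sum (Ψ β) ≡ λ′ + vmax β * d
  Ψ-decomposition λ′≤e β Σβ≡e∸λ′ = begin
      e + sum γ                ≡⟨ cong (_+ sum γ) (m∸n+n≡m λ′≤e) ⟨
      (e ∸ λ′ + λ′) + sum γ    ≡⟨ cong (λ s → (s + λ′) + sum γ) Σβ≡e∸λ′ ⟨
      (sum β + λ′) + sum γ     ≡⟨ solve 3 (λ a b c → (a :+ b) :+ c := b :+ (c :+ a)) refl (sum β) λ′ (sum γ) ⟩
      λ′ + (sum γ + sum β)     ≡⟨ cong (λ′ +_) (sum-map-∸ (vmax β) β (vmax-upperBound β)) ⟩
      λ′ + d * vmax β          ≡⟨ cong (λ′ +_) (*-comm d (vmax β)) ⟩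
      λ′ + vmax β * d          ∎
    where
      open ≡-Reasoning
      γ = Ψ β

  mu-Ψ : λ′ ≤ e → (β : Vec ℕ d) → sum β ≡ e ∸ λ′ → mu d e (Ψ β) ≡ vmax β
  mu-Ψ λ′≤e β Σβ≡e∸λ′ =
    trans (cong (_/ d) (Ψ-decomposition λ′≤e β Σβ≡e∸λ′)) ([m+kn]/n≡k λ′ (vmax β) d λ′<d)

module _ {k : ℕ} (e λ′ : ℕ) (λ′<d : λ′ < suc k) (λ′≤e : λ′ ≤ e) where

  private
    d = suc k

  Ψ-inR : 1 ≤ λ′ → (β : Vec ℕ d) → sum β ≡ e ∸ λ′ → InR d e λ′ (Ψ β)
  Ψ-inR 1≤λ′ β Σβ≡e∸λ′ = map-vmax-∸-hasZero β , d*maxγ<e+Σγ , e+Σγ≡λ′[d]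
    where
      open ≤-Reasoning
      γ = Ψ β
      e+Σγ≡λ′+Bd : e + sum γ ≡ λ′ + vmax β * d
      e+Σγ≡λ′+Bd = Ψ-decomposition d e λ′ λ′<d λ′≤e β Σβ≡e∸λ′
      d*maxγ<e+Σγ : d * vmax γ < e + sum γ
      d*maxγ<e+Σγ = begin-strict
        d * vmax γ        ≤⟨ *-monoʳ-≤ d (vmax-map-∸-≤ (vmax β) β) ⟩
        d * vmax β        ≡⟨ *-comm d (vmax β) ⟩
        vmax β * d        <⟨ m<n+m (vmax β * d) 1≤λ′ ⟩
        λ′ + vmax β * d   ≡⟨ e+Σγ≡λ′+Bd ⟨
        e + sum γ         ∎
      e+Σγ≡λ′[d] : (e + sum γ) % d ≡ λ′ % d
      e+Σγ≡λ′[d] = trans (cong (_% d) e+Σγ≡λ′+Bd) ([m+kn]%n≡m%n λ′ (vmax β) d)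

  Φ∘Ψ : ∀ p (β : Vec ℕ d) → sum β ≡ e ∸ λ′ → Φ p d e (Ψ β) ≡ map (p ^_) β
  Φ∘Ψ p β Σβ≡e∸λ′ = begin
      Φ p d e (Ψ β)                                 ≡⟨ Φ-exponents p d e (Ψ β) ⟩
      map (p ^_) (map (mu d e (Ψ β) ∸_) (Ψ β))      ≡⟨ cong (λ μ → map (p ^_) (map (μ ∸_) (Ψ β))) (mu-Ψ d e λ′ λ′<d λ′≤e β Σβ≡e∸λ′) ⟩
      map (p ^_) (map (vmax β ∸_) (Ψ β))            ≡⟨ cong (map (p ^_)) (map-∸-involutive (vmax β) β (vmax-upperBound β)) ⟩
      map (p ^_) β                                  ∎
    where open ≡-Reasoning

Ψ∘Φ : ∀ {p} → 1 < p → ∀ d e λ′ .{{_ : NonZero d}} → λ′ < d →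
      (α : Vec ℕ d) → InR d e λ′ α → (β : Vec ℕ d) → Φ p d e α ≡ map (p ^_) β → Ψ β ≡ α
Ψ∘Φ {p} 1<p d e λ′ λ′<d α α∈R@(α-hasZero , _) β Φα≡pᵝ = begin
    Ψ β                                         ≡⟨ cong Ψ μ∸α≡β ⟨
    map (vmax (map (μ ∸_) α) ∸_) (map (μ ∸_) α) ≡⟨ cong (λ B → map (B ∸_) (map (μ ∸_) α)) (vmax-map-∸ μ α α-hasZero) ⟩
    map (μ ∸_) (map (μ ∸_) α)                   ≡⟨ map-∸-involutive μ α (InR⇒entries≤mu d e λ′ λ′<d α α∈R) ⟩
    α                                           ∎
  where
    open ≡-Reasoning
    μ = mu d e α
    μ∸α≡β : map (μ ∸_) α ≡ β
    μ∸α≡β = map-injective (^-injectiveʳ 1<p) _ β (trans (sym (Φ-exponents p d e α)) Φα≡pᵝ)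

proposition3p2 : (p e d λ′ : ℕ) → .{{_ : NonZero d}} → Prime p → 2 ≤ e → 2 ≤ d
    → 1 ≤ λ′ → λ′ ≤ e → λ′ ≤ d ∸ 1
    → ((α : Vec ℕ d) → InR d e λ′ α → d * mu d e α + λ′ ≡ e + sum α)
    × ((α : Vec ℕ d) → InR d e λ′ α → IsVecFact p d (e ∸ λ′) (Φ p d e α))
    × ((β : Vec ℕ d) → sum β ≡ e ∸ λ′ → InR d e λ′ (Ψ β) × Φ p d e (Ψ β) ≡ map (p ^_) β)
    × ((α : Vec ℕ d) → InR d e λ′ α → (β : Vec ℕ d) → Φ p d e α ≡ map (p ^_) β → Ψ β ≡ α)
proposition3p2 p e d@(suc _) λ′ p-prime _ _ 1≤λ′ λ′≤e λ′≤d∸1 =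
    mu-equation
  , (λ α α∈R → map (mu d e α ∸_) α , Φ-exponents p d e α , sum-exponents d e λ′ λ′<d λ′≤e α α∈R)
  , (λ β Σβ≡e∸λ′ → Ψ-inR e λ′ λ′<d λ′≤e 1≤λ′ β Σβ≡e∸λ′ , Φ∘Ψ e λ′ λ′<d λ′≤e p β Σβ≡e∸λ′)
  , Ψ∘Φ (nonTrivial⇒n>1 p {{prime⇒nonTrivial p-prime}}) d e λ′ λ′<d
  where
    λ′<d : λ′ < d
    λ′<d = s≤s λ′≤d∸1
    mu-equation : (α : Vec ℕ d) → InR d e λ′ α → d * mu d e α + λ′ ≡ e + sum α
    mu-equation α α∈R = trans (trans (cong (_+ λ′) (*-comm d (mu d e α))) (+-comm _ λ′))
                              (sym (InR-decomposition d e λ′ λ′<d α α∈R))
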